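{- Let $\Gamma=(B_1,\dots,B_n)$ and $\Gamma'=(A_1,\dots,A_n)$ be weak set compositions with $A_i\subseteq B_i$ for all $i$. If the block $B_i$ is deleted in the computation of $\mathsf{park}(\Gamma)$ (blocks numbered by their original positions), then the block $A_i$ is deleted in the computation of $\mathsf{park}(\Gamma')$.
   Context: A weak set composition of a finite set $I$ is a finite list $\Gamma=(A_1,\dots,A_k)$ of pairwise disjoint, possibly empty subsets with union $I$; its length is $\ell(\Gamma)=k$ and its size $|\Gamma|=\sum_i|A_i|$. For a weak set composition $\Gamma=(B_1,\dots,B_k)$, $\mathsf{park}(\Gamma)$ is computed by the following procedure: start with $\Phi=()$; for $i=1,\dots,k$ in order, if $|\Phi|+|B_i|\ge\ell(\Phi)+1$ then append $B_i$ to $\Phi$ (the block $B_i$ is kept), otherwise discard it (the block $B_i$ is deleted); return $\Phi$. -}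

module Defs where

open import Data.Nat using (ℕ; zero; suc; _+_; _≤_; _≤?_)
open import Data.Bool using (Bool; true; false)
open import Data.Fin using (Fin)
open import Data.Fin.Subset using (Subset; ∣_∣; _⊆_; _∩_; Empty)
open import Data.Vec using (Vec; []; _∷_; lookup)
open import Relation.Binary.PropositionalEquality using (_≡_)
open import Relation.Nullary using (¬_; Dec; yes; no)

-- A weak set composition of length n with blocks drawn from a finite
-- universe Fin m: a vector of n pairwise disjoint (possibly empty) subsets.
-- The set it composes is the union of its blocks.
WeakSetComp : ℕ → ℕ → Set
WeakSetComp m n = Vec (Subset m) n

PairwiseDisjoint : ∀ {m n} → WeakSetComp m n → Set
PairwiseDisjoint {m} {n} Γ =
  (i j : Fin n) → ¬ (i ≡ j) → Empty (lookup Γ i ∩ lookup Γ j)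

-- The park procedure, recording for each block whether it is kept (true)
-- or deleted (false).  The auxiliary arguments s and l are the current
-- size |Φ| and length ℓ(Φ) of the partially built Φ.
parkFlagsFrom : ∀ {m n} → ℕ → ℕ → Vec (Subset m) n → Vec Bool n
parkFlagsFrom s l [] = []
parkFlagsFrom s l (B ∷ Bs) with suc l ≤? s + ∣ B ∣
... | yes _ = true ∷ parkFlagsFrom (s + ∣ B ∣) (suc l) Bs
... | no _  = false ∷ parkFlagsFrom s l Bs

parkFlags : ∀ {m n} → WeakSetComp m n → Vec Bool n
parkFlags = parkFlagsFrom 0 0

Deleted : ∀ {m n} → WeakSetComp m n → Fin n → Set
Deleted Γ i = lookup (parkFlags Γ) i ≡ false

{-# OPTIONS --safe #-}
module Submission where

open import Defs
open import Data.Nat using (ℕ; suc; _+_; _≤_; _≤?_; s≤s)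
open import Data.Nat.Properties
  using ( ≤-refl; ≤-trans; ≮⇒≥; m≤m+n; +-comm; +-suc; +-mono-≤; +-monoˡ-≤; +-monoʳ-≤
        ; +-cancelʳ-≤; +-commutativeSemigroup; module ≤-Reasoning)
open import Algebra.Properties.CommutativeSemigroup +-commutativeSemigroup using (xy∙z≈xz∙y)
open import Data.Bool as Bool using (false; f≤t; b≤b)
import Data.Bool.Properties as Bool
open import Data.Fin using (Fin)
open import Data.Fin.Subset using (Subset; _⊆_; ∣_∣)
open import Data.Fin.Subset.Properties using (p⊆q⇒∣p∣≤∣q∣)
open import Data.Vec using (Vec; _∷_; lookup)
open import Data.Vec.Relation.Binary.Pointwise.Inductive as Pointwise using (Pointwise; []; _∷_)
open import Data.Vec.Relation.Binary.Pointwise.Extensional using (ext; extensional⇒inductive)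
open import Relation.Binary.PropositionalEquality using (cong; subst)
open import Relation.Nullary using (¬_; yes; no; contradiction)

-- Write σ = s − l for the slack of a state (s, l) of the park procedure, i.e. |Φ| − ℓ(Φ).
-- A block B is kept iff σ + |B| ≥ 1, and then the slack becomes σ + |B| − 1; otherwise it
-- is unchanged.  Running park on Γ′ and Γ side by side, the slack of Γ′ never exceeds that
-- of Γ, so since |A_i| ≤ |B_i| a kept A_i forces a kept B_i.

-- s′ + l ≤ s + l′ is "the slack of (s′, l′) is at most that of (s, l)" without truncated
-- subtraction.

module _ {s l s′ l′ a b : ℕ} (slack≤ : s′ + l ≤ s + l′) (a≤b : a ≤ b) where

  slack+size-mono : s′ + a + l ≤ s + b + l′
  slack+size-mono = begin
    s′ + a + l   ≡⟨ xy∙z≈xz∙y s′ a l ⟩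
    s′ + l + a   ≤⟨ +-mono-≤ slack≤ a≤b ⟩
    s + l′ + b   ≡⟨ xy∙z≈xz∙y s l′ b ⟩
    s + b + l′   ∎
    where open ≤-Reasoning

  kept-mono : suc l′ ≤ s′ + a → suc l ≤ s + b
  kept-mono A-kept = +-cancelʳ-≤ l′ (suc l) (s + b) (begin
    suc l + l′   ≡⟨ cong suc (+-comm l l′) ⟩
    suc l′ + l   ≤⟨ +-monoˡ-≤ l A-kept ⟩
    s′ + a + l   ≤⟨ slack+size-mono ⟩
    s + b + l′   ∎)
    where open ≤-Reasoning

  kept-kept-slack≤ : s′ + a + suc l ≤ s + b + suc l′
  kept-kept-slack≤ = begin
    s′ + a + suc l     ≡⟨ +-suc (s′ + a) l ⟩
    suc (s′ + a + l)   ≤⟨ s≤s slack+size-mono ⟩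
    suc (s + b + l′)   ≡⟨ +-suc (s + b) l′ ⟨
    s + b + suc l′     ∎
    where open ≤-Reasoning

deleted-kept-slack≤ : ∀ {s l s′ l′ a b : ℕ} →
  ¬ suc l′ ≤ s′ + a → suc l ≤ s + b → s′ + suc l ≤ s + b + l′
deleted-kept-slack≤ {s} {l} {s′} {l′} {a} {b} A-deleted B-kept = begin
  s′ + suc l    ≤⟨ +-monoˡ-≤ (suc l) (≤-trans (m≤m+n s′ a) (≮⇒≥ A-deleted)) ⟩
  l′ + suc l    ≤⟨ +-monoʳ-≤ l′ B-kept ⟩
  l′ + (s + b)  ≡⟨ +-comm l′ (s + b) ⟩
  s + b + l′    ∎
  where open ≤-Reasoning

parkFlagsFrom-mono : ∀ {m m′ n} {s l s′ l′ : ℕ}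
  {As : Vec (Subset m′) n} {Bs : Vec (Subset m) n} →
  s′ + l ≤ s + l′ → Pointwise (λ A B → ∣ A ∣ ≤ ∣ B ∣) As Bs →
  Pointwise Bool._≤_ (parkFlagsFrom s′ l′ As) (parkFlagsFrom s l Bs)
parkFlagsFrom-mono slack≤ [] = []
parkFlagsFrom-mono {s = s} {l} {s′} {l′} {A ∷ _} {B ∷ _} slack≤ (a≤b ∷ sizes≤)
  with suc l′ ≤? s′ + ∣ A ∣ | suc l ≤? s + ∣ B ∣
... | yes _        | yes _        =
  b≤b ∷ parkFlagsFrom-mono (kept-kept-slack≤ slack≤ a≤b) sizes≤
... | yes A-kept   | no B-deleted = contradiction (kept-mono slack≤ a≤b A-kept) B-deleted
... | no A-deleted | yes B-kept   =
  f≤t ∷ parkFlagsFrom-mono (deleted-kept-slack≤ {s = s} {b = ∣ B ∣} A-deleted B-kept) sizes≤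
... | no _         | no _         = b≤b ∷ parkFlagsFrom-mono slack≤ sizes≤

lemma4p6 : (m n : ℕ) (Γ Γ′ : WeakSetComp m n) →
    PairwiseDisjoint Γ → PairwiseDisjoint Γ′ →
    ((i : Fin n) → lookup Γ′ i ⊆ lookup Γ i) →
    (i : Fin n) → Deleted Γ i → Deleted Γ′ i
lemma4p6 m n Γ Γ′ _ _ Γ′⊆Γ i Γᵢ-deleted =
  Bool.≤-antisym flag′ᵢ≤false (Bool.≤-minimum _)
  where
    sizes≤ : Pointwise (λ A B → ∣ A ∣ ≤ ∣ B ∣) Γ′ Γ
    sizes≤ = extensional⇒inductive (ext (λ j → p⊆q⇒∣p∣≤∣q∣ (Γ′⊆Γ j)))

    flags≤ : Pointwise Bool._≤_ (parkFlags Γ′) (parkFlags Γ)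
    flags≤ = parkFlagsFrom-mono ≤-refl sizes≤

    flag′ᵢ≤false : lookup (parkFlags Γ′) i Bool.≤ false
    flag′ᵢ≤false = subst (_ Bool.≤_) Γᵢ-deleted (Pointwise.lookup flags≤ i)
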